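{- Let $L$ be a language with $L\in\mathrm{Alt}(f)$ for some $f:\mathbb{N}\to\mathbb{N}$. Then there exists a constant $C$ such that for all $n\in\mathbb{N}$, there exists a family of $C\cdot f(n)$ languages whose generated lattice contains all the left quotients of $L$ of order $n$.
   Context: For a language $L$ and word $u$, the left quotient is $u^{ -1}L = \{v \mid uv\in L\}$; if $|u|\le n$ it is called a left quotient of $L$ of order $n$. A lattice of languages is a set of languages closed under (finite) union and intersection; the lattice generated by a family is the smallest lattice containing it. An alternating machine over a finite alphabet $A$ consists of a (possibly infinite) set of states $Q$, an initial state $q_0\in Q$, a transition function $\delta: Q\times A\to\mathcal{B}^+(Q)$ (positive boolean formulae over $Q$) and a set $F\subseteq Q$ of accepting states. For an input word $w$, the acceptance game $\mathcal{G}_{\mathcal{A},w}$ is played by Prover and Verifier: starting in $q_0$, the letters of $w$ are read from left to right; in state $q$ reading letter $a$, the next state is obtained from the formula $\delta(q,a)$, Prover resolving disjunctions and Verifier resolving conjunctions. Prover wins a play if it ends in a state of $F$. The word $w$ is accepted if Prover has a winning strategy; the language recognised is the set of accepted words. For $f:\mathbb{N}\to\mathbb{N}$, a language $L$ is in $\mathrm{Alt}(f)$ if there are an alternating machine recognising $L$ and a constant $C$ such that for all $n\in\mathbb{N}$, the number of states $q$ for which there exists a word $w$ of length at most $n$ with $q$ appearing in the game $\mathcal{G}_{\mathcal{A},w}$ is at most $C\cdot f(n)$. -}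

module Defs where

open import Data.Nat using (ℕ; _*_; _≤_)
open import Data.Fin using (Fin)
open import Data.List using (List; []; _∷_; _++_; length)
open import Data.Product using (Σ; ∃; _×_; _,_)
open import Data.Sum using (_⊎_)
open import Data.Unit using (⊤)
open import Data.Empty using (⊥)
open import Function.Bundles using (_⇔_)
open import Relation.Binary.PropositionalEquality using (_≡_)

Word : ℕ → Set
Word k = List (Fin k)

Language : ℕ → Set₁
Language k = Word k → Set

leftQuotient : ∀ {k} → Word k → Language k → Language k
leftQuotient u L v = L (u ++ v)

data PBF (Q : Set) : Set where
  atom : Q → PBF Q
  tt ff : PBF Q
  _∧_ _∨_ : PBF Q → PBF Q → PBF Q

record AltMachine (k : ℕ) : Set₁ where
  field
    Q  : Set
    q₀ : Q
    δ  : Q → Fin k → PBF Q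
    F  : Q → Set

module _ {k : ℕ} (M : AltMachine k) where
  open AltMachine M

  mutual
    -- Prover wins the acceptance game started in state q on the remaining input.
    Win : Q → Word k → Set
    Win q []      = F q
    Win q (a ∷ w) = WinF (δ q a) w

    WinF : PBF Q → Word k → Set
    WinF (atom q) w = Win q w
    WinF tt       w = ⊤
    WinF ff       w = ⊥
    WinF (φ ∧ ψ)  w = WinF φ w × WinF ψ w
    WinF (φ ∨ ψ)  w = WinF φ w ⊎ WinF ψ w

  Accepts : Word k → Set
  Accepts w = Win q₀ w

  data _∈atoms_ (q : Q) : PBF Q → Set where
    here : q ∈atoms atom q
    ∧ˡ : ∀ {φ ψ} → q ∈atoms φ → q ∈atoms (φ ∧ ψ)
    ∧ʳ : ∀ {φ ψ} → q ∈atoms ψ → q ∈atoms (φ ∧ ψ)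
    ∨ˡ : ∀ {φ ψ} → q ∈atoms φ → q ∈atoms (φ ∨ ψ)
    ∨ʳ : ∀ {φ ψ} → q ∈atoms ψ → q ∈atoms (φ ∨ ψ)

  data Occurs : Q → Word k → Q → Set where
    start : ∀ {p w} → Occurs p w p
    step  : ∀ {p a w p' q} → p' ∈atoms δ p a → Occurs p' w q → Occurs p (a ∷ w) q

  AppearsIn : Word k → Q → Set
  AppearsIn w q = Occurs q₀ w q

  AppearingBound : ℕ → ℕ → Set
  AppearingBound n N =
    Σ (Fin N → Q) λ g → ∀ q (w : Word k) → length w ≤ n → AppearsIn w q → ∃ λ i → g i ≡ q

Recognises : ∀ {k} → AltMachine k → Language k → Set
Recognises M L = ∀ w → L w ⇔ Accepts M w

Alt : ∀ {k} → (ℕ → ℕ) → Language k → Set₁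
Alt {k} f L = Σ (AltMachine k) λ M → Recognises M L × Σ ℕ λ C → ∀ n → AppearingBound M n (C * f n)

data LatticeTerm (m : ℕ) : Set where
  gen : Fin m → LatticeTerm m
  _∪ₜ_ _∩ₜ_ : LatticeTerm m → LatticeTerm m → LatticeTerm m

⟦_⟧ₜ : ∀ {k m} → LatticeTerm m → (Fin m → Language k) → Language k
⟦ gen i ⟧ₜ    fam w = fam i w
⟦ s ∪ₜ t ⟧ₜ   fam w = ⟦ s ⟧ₜ fam w ⊎ ⟦ t ⟧ₜ fam w
⟦ s ∩ₜ t ⟧ₜ   fam w = ⟦ s ⟧ₜ fam w × ⟦ t ⟧ₜ fam w

InGeneratedLattice : ∀ {k m} → (Fin m → Language k) → Language k → Set
InGeneratedLattice fam K = ∃ λ t → ∀ w → ⟦ t ⟧ₜ fam w ⇔ K w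

-- A quotient u⁻¹L is the language accepted from the initial position after u has been read,
-- i.e. the formula obtained by unfolding δ along u, evaluated on the remaining input. Its atoms
-- are states appearing in the game on u, so u⁻¹L is a union/intersection of the languages L_q
-- of those states, together with ⊤ and ⊥ for the constant subformulae. For |u| ≤ n there are
-- at most C · f n such states, and ⊤, ⊥ fit into the family by enlarging C by 2.
module Submission where

open import Defs
open import Data.Nat using (ℕ; suc; _*_; _+_; _≤_; z≤n)
open import Data.Fin using (Fin; _↑ˡ_; _↑ʳ_; quotRem)
open import Data.List using ([]; _∷_; _++_; length)
open import Data.Product using (Σ; ∃; _×_; _,_; proj₁)
open import Data.Product.Function.NonDependent.Propositional using (_×-⇔_)
open import Data.Sum using (_⊎_)
open import Data.Sum.Function.Propositional using (_⊎-⇔_)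
open import Data.Unit using (⊤)
open import Data.Empty using (⊥)
open import Data.Vec.Functional using (Vector) renaming (_++_ to _++ᵛ_)
open import Data.Vec.Functional.Properties using (lookup-++ˡ; lookup-++ʳ)
open import Function using (id; const; _∘_)
open import Function.Bundles using (_⇔_; mk⇔)
open import Function.Construct.Composition using (_⇔-∘_)
open import Function.Construct.Symmetry using (⇔-sym)
open import Relation.Binary.PropositionalEquality using (_≡_; refl; trans)

module _ {k m : ℕ} (fam : Fin m → Language k) where

  gen-∈ : ∀ {K} i → fam i ≡ K → InGeneratedLattice fam K
  gen-∈ i refl = gen i , λ _ → mk⇔ id id

  ∩-∈ : ∀ {K K′} → InGeneratedLattice fam K → InGeneratedLattice fam K′ →
        InGeneratedLattice fam (λ w → K w × K′ w)
  ∩-∈ (s , s⇔K) (t , t⇔K′) = s ∩ₜ t , λ w → s⇔K w ×-⇔ t⇔K′ w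

  ∪-∈ : ∀ {K K′} → InGeneratedLattice fam K → InGeneratedLattice fam K′ →
        InGeneratedLattice fam (λ w → K w ⊎ K′ w)
  ∪-∈ (s , s⇔K) (t , t⇔K′) = s ∪ₜ t , λ w → s⇔K w ⊎-⇔ t⇔K′ w

  ∈-resp-⇔ : ∀ {K K′} → (∀ w → K w ⇔ K′ w) →
             InGeneratedLattice fam K → InGeneratedLattice fam K′
  ∈-resp-⇔ K⇔K′ (t , t⇔K) = t , λ w → K⇔K′ w ⇔-∘ t⇔K w

module _ {k m : ℕ} (M : AltMachine k) (fam : Fin m → Language k)
         (⊤-∈ : InGeneratedLattice fam (const ⊤)) (⊥-∈ : InGeneratedLattice fam (const ⊥)) where
  open AltMachine M

  mutual
    quotient-Win-∈ : ∀ u p → (∀ q → Occurs M p u q → InGeneratedLattice fam (Win M q)) →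
                     InGeneratedLattice fam (λ v → Win M p (u ++ v))
    quotient-Win-∈ []      p states-∈ = states-∈ p start
    quotient-Win-∈ (a ∷ u) p states-∈ =
      quotient-WinF-∈ u (δ p a) λ p′ p′∈δ q occ → states-∈ q (step p′∈δ occ)

    quotient-WinF-∈ : ∀ u φ →
                      (∀ p → _∈atoms_ M p φ → ∀ q → Occurs M p u q → InGeneratedLattice fam (Win M q)) →
                      InGeneratedLattice fam (λ v → WinF M φ (u ++ v))
    quotient-WinF-∈ u (atom p) states-∈ = quotient-Win-∈ u p (states-∈ p here)
    quotient-WinF-∈ u tt       states-∈ = ⊤-∈
    quotient-WinF-∈ u ff       states-∈ = ⊥-∈
    quotient-WinF-∈ u (φ ∧ ψ)  states-∈ =
      ∩-∈ fam (quotient-WinF-∈ u φ (λ p → states-∈ p ∘ ∧ˡ))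
              (quotient-WinF-∈ u ψ (λ p → states-∈ p ∘ ∧ʳ))
    quotient-WinF-∈ u (φ ∨ ψ)  states-∈ =
      ∪-∈ fam (quotient-WinF-∈ u φ (λ p → states-∈ p ∘ ∨ˡ))
              (quotient-WinF-∈ u ψ (λ p → states-∈ p ∘ ∨ʳ))

-- Laid out so that (2 + C) * f n unfolds to f n + (f n + C * f n) with m = f n, N = C * f n.
module StateFamily {k N : ℕ} (M : AltMachine k) (g : Fin N → AltMachine.Q M) {m : ℕ} (i₀ : Fin m) where

  tops bottoms : Vector (Language k) m
  tops    = const (const ⊤)
  bottoms = const (const ⊥)

  states : Vector (Language k) N
  states = Win M ∘ g

  family : Vector (Language k) (m + (m + N))
  family = tops ++ᵛ (bottoms ++ᵛ states)

  ⊤-∈ : InGeneratedLattice family (const ⊤)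
  ⊤-∈ = gen-∈ family (i₀ ↑ˡ (m + N)) (lookup-++ˡ tops (bottoms ++ᵛ states) i₀)

  ⊥-∈ : InGeneratedLattice family (const ⊥)
  ⊥-∈ = gen-∈ family (m ↑ʳ (i₀ ↑ˡ N))
          (trans (lookup-++ʳ tops (bottoms ++ᵛ states) (i₀ ↑ˡ N)) (lookup-++ˡ bottoms states i₀))

  state-∈ : ∀ {q} → ∃ (λ j → g j ≡ q) → InGeneratedLattice family (Win M q)
  state-∈ (j , refl) = gen-∈ family (m ↑ʳ (m ↑ʳ j))
    (trans (lookup-++ʳ tops (bottoms ++ᵛ states) (m ↑ʳ j)) (lookup-++ʳ bottoms states j))

theorem2 : ∀ {k : ℕ} (f : ℕ → ℕ) (L : Language k) → Alt f L →
    Σ ℕ λ C → ∀ (n : ℕ) → Σ (Fin (C * f n) → Language k) λ fam →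
      ∀ (u : Word k) → length u ≤ n → InGeneratedLattice fam (leftQuotient u L)
theorem2 f L (M , recognises , C , bound) = suc (suc C) , λ n →
  let (g , covers) = bound n
      -- q₀ appears in the game on the empty word, so Fin (C * f n), hence Fin (f n), is inhabited.
      i₀ = proj₁ (quotRem {C} (f n) (proj₁ (covers (AltMachine.q₀ M) [] z≤n start)))
      open StateFamily M g i₀
  in family , λ u |u|≤n →
       ∈-resp-⇔ family (λ v → ⇔-sym (recognises (u ++ v)))
         (quotient-Win-∈ M family ⊤-∈ ⊥-∈ u (AltMachine.q₀ M)
           (λ q appears → state-∈ (covers q u |u|≤n appears)))
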